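{- Let $\Delta=({\mathcal V},{\mathcal D})$ be a digraph without sources and sinks admitting a dart-transitive group of symmetries $G$, and let $\Gamma=\mathrm{SBP}(\Delta,\Delta^{ -1})$. Let $G\times G$ act on the vertices of $\Gamma$ by $(a,x,i)^{(g_1,g_2)}=(a^{g_1},x^{g_2},i)$, and let $\mu$ be the reversal of $\Gamma$ given by $(a,x,i)^\mu=(x,a,i)$. Then $\langle G\times G,\mu\rangle$ acts edge-transitively but not vertex-transitively on the underlying graph of $\Gamma$.
   Context: A digraph is a pair $({\mathcal V},{\mathcal D})$ with ${\mathcal V}$ a finite non-empty set and ${\mathcal D}$ a set of ordered pairs of distinct vertices (darts). A source (sink) is a vertex of in-valence (out-valence) $0$. A symmetry is a vertex permutation preserving the darts; dart-transitive means transitive on darts. The reverse of $\Delta$ is $\Delta^{ -1}=({\mathcal V},{\mathcal D}^{ -1})$ with ${\mathcal D}^{ -1}=\{(v,u):(u,v)\in{\mathcal D}\}$ (note $G\le{\rm Aut}(\Delta^{ -1})$ as well); a reversal is an isomorphism from a digraph to its reverse. The underlying graph of a digraph is $({\mathcal V},{\mathcal D}\cup{\mathcal D}^{ -1})$. $\mathrm{SBP}(\Gamma_1,\Gamma_2)$ for $\Gamma_j=({\mathcal V}_j,{\mathcal D}_j)$ has vertex set ${\mathcal V}_1\times{\mathcal V}_2\times\mathbb Z_2$ and darts all $((a,x,0),(b,x,1))$ with $(a,b)\in{\mathcal D}_1$, $x\in{\mathcal V}_2$, and all $((a,x,1),(a,y,0))$ with $a\in{\mathcal V}_1$, $(x,y)\in{\mathcal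 D}_2$. -}

module Defs where

open import Level using (0ℓ)
open import Data.Nat using (ℕ; _≥_)
open import Data.Fin using (Fin)
open import Data.Product using (Σ; ∃; _×_; _,_)
open import Data.Sum using (_⊎_)
open import Data.List using (List; []; _∷_; foldr)
open import Relation.Nullary using (¬_)
open import Relation.Binary.PropositionalEquality using (_≡_)
open import Function using (id; _∘_; _⇔_)

record Digraph : Set₁ where
  field
    n        : ℕ
    nonEmpty : n ≥ 1
    D        : Fin n → Fin n → Set
    irrefl   : ∀ v → ¬ D v v

open Digraph public

reverse : Digraph → Digraph
reverse Δ = record
  { n = n Δ ; nonEmpty = nonEmpty Δ
  ; D = λ u v → D Δ v u ; irrefl = λ v → irrefl Δ v }

NoSources : Digraph → Set
NoSources Δ = ∀ v → ∃ λ u → D Δ u v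

NoSinks : Digraph → Set
NoSinks Δ = ∀ v → ∃ λ w → D Δ v w

record SymmetryGroup (Δ : Digraph) : Set₁ where
  field
    InG   : (Fin (n Δ) → Fin (n Δ)) → Set
    id∈   : InG id
    comp∈ : ∀ {g h} → InG g → InG h → InG (g ∘ h)
    inv∈  : ∀ {g} → InG g →
            Σ (Fin (n Δ) → Fin (n Δ)) λ h →
              InG h × (∀ x → h (g x) ≡ x) × (∀ x → g (h x) ≡ x)
    pres  : ∀ {g} → InG g → ∀ u v → (D Δ u v ⇔ D Δ (g u) (g v))

open SymmetryGroup public

DartTransitive : (Δ : Digraph) → SymmetryGroup Δ → Set
DartTransitive Δ G =
  ∀ u v u' v' → D Δ u v → D Δ u' v' →
  Σ (Fin (n Δ) → Fin (n Δ)) λ g → InG G g × g u ≡ u' × g v ≡ v'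

SBPVertex : Digraph → Digraph → Set
SBPVertex Γ₁ Γ₂ = Fin (n Γ₁) × Fin (n Γ₂) × Fin 2

data SBPDart (Γ₁ Γ₂ : Digraph) : SBPVertex Γ₁ Γ₂ → SBPVertex Γ₁ Γ₂ → Set where
  dart₀₁ : ∀ {a b} x → D Γ₁ a b →
           SBPDart Γ₁ Γ₂ (a , x , Fin.zero) (b , x , Fin.suc Fin.zero)
  dart₁₀ : ∀ a {x y} → D Γ₂ x y →
           SBPDart Γ₁ Γ₂ (a , x , Fin.suc Fin.zero) (a , y , Fin.zero)

UEdge : {V : Set} → (V → V → Set) → V → V → Set
UEdge R u v = R u v ⊎ R v u

module _ (Δ : Digraph) where
  Γ-V : Set
  Γ-V = SBPVertex Δ (reverse Δ)

  Γ-D : Γ-V → Γ-V → Set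
  Γ-D = SBPDart Δ (reverse Δ)

  μ : Γ-V → Γ-V
  μ (a , x , i) = (x , a , i)

  data Generator (G : SymmetryGroup Δ) : Set where
    pairGen : (g₁ g₂ : Fin (n Δ) → Fin (n Δ)) → InG G g₁ → InG G g₂ → Generator G
    muGen   : Generator G

  actGen : {G : SymmetryGroup Δ} → Generator G → Γ-V → Γ-V
  actGen (pairGen g₁ g₂ _ _) (a , x , i) = (g₁ a , g₂ x , i)
  actGen muGen v = μ v

  -- Elements of ⟨G × G, μ⟩ are words in the generators (the generating set
  -- is closed under inverses, so words give the whole generated group).
  actWord : {G : SymmetryGroup Δ} → List (Generator G) → Γ-V → Γ-V
  actWord w = foldr (λ s f → f ∘ actGen s) id w

  EdgeTransitive : SymmetryGroup Δ → Set
  EdgeTransitive G =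
    ∀ u v u' v' → UEdge Γ-D u v → UEdge Γ-D u' v' →
    Σ (List (Generator G)) λ w →
      (actWord w u ≡ u' × actWord w v ≡ v') ⊎ (actWord w u ≡ v' × actWord w v ≡ u')

  VertexTransitive : SymmetryGroup Δ → Set
  VertexTransitive G =
    ∀ (u v : Γ-V) → Σ (List (Generator G)) λ w → actWord w u ≡ v

-- Every element of ⟨G × G, μ⟩ fixes the ℤ₂-coordinate (the layer), so the two layers
-- are distinct orbits on vertices. On edges, the darts (a , x , 0) → (b , x , 1) with
-- a → b in Δ form a single orbit of G × G, since G is transitive on the darts of Δ and
-- (having no sources) on its vertices; μ reverses the darts (a , x , 1) → (a , y , 0)
-- into darts of that form.
module Submission where

open import Defs
open import Data.Product as Product using (_×_; Σ; _,_; proj₂)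
open import Data.Sum as Sum using (_⊎_; inj₁; inj₂)
open import Data.Fin using (Fin; zero; suc; fromℕ<)
open import Data.Fin.Properties using (0≢1+n)
open import Data.List using (List; []; _∷_)
open import Relation.Nullary using (¬_)
open import Relation.Binary.PropositionalEquality using (_≡_; refl; sym; trans; cong)
open import Function using (_∘_)

dartTransitive⇒vertexTransitive : (Δ : Digraph) → NoSources Δ →
  (G : SymmetryGroup Δ) → DartTransitive Δ G →
  ∀ (u v : Fin (n Δ)) → Σ (Fin (n Δ) → Fin (n Δ)) λ g → InG G g × g u ≡ v
dartTransitive⇒vertexTransitive Δ noSources G dartTransitive u v
  with noSources u | noSources v
... | s , s→u | t , t→v with dartTransitive s u t v s→u t→v
...   | g , g∈G , _ , gu≡v = g , g∈G , gu≡v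

module _ (Δ : Digraph) (G : SymmetryGroup Δ) where

  Word : Set
  Word = List (Generator Δ G)

  layer : Γ-V Δ → Fin 2
  layer = proj₂ ∘ proj₂

  actWord-layer : ∀ (w : Word) v → layer (actWord Δ w v) ≡ layer v
  actWord-layer []                      v           = refl
  actWord-layer (pairGen g₁ g₂ _ _ ∷ w) (a , x , i) = actWord-layer w (g₁ a , g₂ x , i)
  actWord-layer (muGen ∷ w)             (a , x , i) = actWord-layer w (x , a , i)

  ¬vertexTransitive : ¬ VertexTransitive Δ G
  ¬vertexTransitive vertexTransitive
    with vertexTransitive (v₀ , v₀ , zero) (v₀ , v₀ , suc zero)
    where v₀ = fromℕ< {0} (nonEmpty Δ)
  ... | w , w-maps = 0≢1+n (trans (sym (actWord-layer w _)) (cong layer w-maps))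

  CarriesEdge : Word → Γ-V Δ → Γ-V Δ → Γ-V Δ → Γ-V Δ → Set
  CarriesEdge w u v u' v' =
    (actWord Δ w u ≡ u' × actWord Δ w v ≡ v') ⊎ (actWord Δ w u ≡ v' × actWord Δ w v ≡ u')

  module _ (g₁ g₂ : Fin (n Δ) → Fin (n Δ)) (g₁∈G : InG G g₁) (g₂∈G : InG G g₂) where

    pair-carriesEdge : ∀ {a b x y a' b' x' y' i j} →
      g₁ a ≡ a' → g₂ x ≡ x' → g₁ b ≡ b' → g₂ y ≡ y' →
      Σ Word λ w → CarriesEdge w (a , x , i) (b , y , j) (a' , x' , i) (b' , y' , j)
    pair-carriesEdge refl refl refl refl =
      pairGen g₁ g₂ g₁∈G g₂∈G ∷ [] , inj₁ (refl , refl)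

    pairμ-carriesEdge : ∀ {a b x y a' b' x' y' i j} →
      g₁ a ≡ a' → g₂ x ≡ x' → g₁ b ≡ b' → g₂ y ≡ y' →
      Σ Word λ w → CarriesEdge w (a , x , i) (b , y , j) (y' , b' , j) (x' , a' , i)
    pairμ-carriesEdge refl refl refl refl =
      pairGen g₁ g₂ g₁∈G g₂∈G ∷ muGen ∷ [] , inj₂ (refl , refl)

flipBoth : ∀ {A B C D : Set} → (A × B) ⊎ (C × D) → (B × A) ⊎ (D × C)
flipBoth = Sum.map Product.swap Product.swap

module _ (Δ : Digraph) (noSources : NoSources Δ)
         (G : SymmetryGroup Δ) (dartTransitive : DartTransitive Δ G) where

  private
    vertexTransitive = dartTransitive⇒vertexTransitive Δ noSources G dartTransitive

  dart-carriesEdge : ∀ {u v u' v'} → Γ-D Δ u v → Γ-D Δ u' v' →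
    Σ (Word Δ G) λ w → CarriesEdge Δ G w u v u' v'
  dart-carriesEdge (dart₀₁ {a} {b} x a→b) (dart₀₁ {a'} {b'} x' a'→b')
    with dartTransitive a b a' b' a→b a'→b' | vertexTransitive x x'
  ... | g₁ , g₁∈G , g₁a , g₁b | g₂ , g₂∈G , g₂x =
    pair-carriesEdge Δ G g₁ g₂ g₁∈G g₂∈G g₁a g₂x g₁b g₂x
  dart-carriesEdge (dart₁₀ a {x} {y} y→x) (dart₁₀ a' {x'} {y'} y'→x')
    with vertexTransitive a a' | dartTransitive y x y' x' y→x y'→x'
  ... | g₁ , g₁∈G , g₁a | g₂ , g₂∈G , g₂y , g₂x =
    pair-carriesEdge Δ G g₁ g₂ g₁∈G g₂∈G g₁a g₂x g₁a g₂y
  dart-carriesEdge (dart₀₁ {a} {b} x a→b) (dart₁₀ a' {x'} {y'} y'→x')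
    with dartTransitive a b y' x' a→b y'→x' | vertexTransitive x a'
  ... | g₁ , g₁∈G , g₁a , g₁b | g₂ , g₂∈G , g₂x =
    pairμ-carriesEdge Δ G g₁ g₂ g₁∈G g₂∈G g₁a g₂x g₁b g₂x
  dart-carriesEdge (dart₁₀ a {x} {y} y→x) (dart₀₁ {a'} {b'} x' a'→b')
    with vertexTransitive a x' | dartTransitive y x a' b' y→x a'→b'
  ... | g₁ , g₁∈G , g₁a | g₂ , g₂∈G , g₂y , g₂x =
    pairμ-carriesEdge Δ G g₁ g₂ g₁∈G g₂∈G g₁a g₂x g₁a g₂y

  edgeTransitive : EdgeTransitive Δ G
  edgeTransitive u v u' v' (inj₁ u→v) (inj₁ u'→v') = dart-carriesEdge u→v u'→v'
  edgeTransitive u v u' v' (inj₁ u→v) (inj₂ v'→u') =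
    let w , maps = dart-carriesEdge u→v v'→u' in w , Sum.swap maps
  edgeTransitive u v u' v' (inj₂ v→u) (inj₁ u'→v') =
    let w , maps = dart-carriesEdge v→u u'→v' in w , Sum.swap (flipBoth maps)
  edgeTransitive u v u' v' (inj₂ v→u) (inj₂ v'→u') =
    let w , maps = dart-carriesEdge v→u v'→u' in w , flipBoth maps

corollary3p5 : (Δ : Digraph) → NoSources Δ → NoSinks Δ →
    (G : SymmetryGroup Δ) → DartTransitive Δ G →
    EdgeTransitive Δ G × ¬ VertexTransitive Δ G
corollary3p5 Δ noSources _ G dartTransitive =
  edgeTransitive Δ noSources G dartTransitive , ¬vertexTransitive Δ G
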